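{- Let $q\geq 3$ and $n\geq 1$ be integers. For each $1\leq i\leq n$, let $v_i$ be a given vertex of the Hamming graph $H(n,q)$. Then there exists a vertex $w$ of $H(n,q)$ such that \[ \left|\left(1-\tfrac1q\right)n-d(v_i,w)\right|<i \quad\text{for all } 1\leq i\leq n. \]
   Context: The Hamming graph $H(n,q)$ has vertex set $\{1,\ldots,q\}^n$, two vertices being adjacent iff they differ in exactly one coordinate; $d(u,v)$ denotes the graph distance, which equals the number of coordinates in which $u$ and $v$ differ. -}

module Defs where

open import Data.Nat using (ℕ; suc; zero; _+_)
open import Data.Fin using (Fin; zero; suc)
open import Data.Fin.Properties using (_≟_)
open import Relation.Nullary using (does)
open import Data.Bool using (if_then_else_)

Vertex : ℕ → ℕ → Set
Vertex n q = Fin n → Fin q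

-- Hamming distance: number of coordinates in which u and v differ
-- (equal to the graph distance in H(n,q), as stated in the context).
dist : {n q : ℕ} → Vertex n q → Vertex n q → ℕ
dist {zero}  u v = 0
dist {suc n} u v =
  (if does (u zero ≟ v zero) then 0 else 1) + dist (λ i → u (suc i)) (λ i → v (suc i))

{-# OPTIONS --safe #-}
module Submission where

-- Iterated rounding.  A fractional vertex P of H(n,q) assigns to every coordinate t a probability
-- distribution P (t , -) on the alphabet, and the agreement with a vertex u extends to the linear
-- functional P ↦ ∑ₜ P (t , u t), which equals n/q for every u at the uniform point.  While the
-- agreements with v₁, …, v_k are kept fixed, a point whose support has more than n + k elements
-- admits a nonzero direction in the kernel of these k functionals and of the n row sums; walking
-- along it until an entry vanishes shrinks the support.  Once there are at most n + k support
-- elements, at most k coordinates t have P (t , v_k t) strictly between 0 and 1, each contributing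
-- an error < 1, so every vertex inside the support agrees with v_k up to an error < k and v_k can
-- be released.  Repeating this for k = n, …, 1 and picking any vertex w inside the final support
-- proves the theorem, as n − d(v_i, w) is the agreement of w with v_i.

open import Defs using (Vertex; dist)
open import Data.Bool.Base using (Bool; true; false; if_then_else_; _∧_; not)
import Data.Bool.Properties as Bool
open import Data.Nat.Base as ℕ using (ℕ; zero; suc; z≤n; s≤s; NonZero; _≥_)
open import Data.Integer.Base as ℤ using (+_; +<+)
import Data.Integer.Properties as ℤ
import Data.Integer.Solver as ℤ
open import Data.Fin.Base using (Fin; zero; suc; toℕ; fromℕ; inject₁; punchIn; punchOut; _↑ˡ_; _↑ʳ_)
open import Data.Fin.Properties using (_≟_; any?; punchInᵢ≢i; punchIn-punchOut; splitAt-↑ˡ; splitAt-↑ʳ; toℕ-fromℕ; toℕ-inject₁)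
open import Data.Fin.Relation.Unary.Top using (View; view; ‵fromℕ; ‵inj₁)
open import Data.List.Base using (List; []; _∷_; cartesianProduct; allFin)
open import Data.List.Relation.Unary.All as All using (All; []; _∷_)
open import Data.List.Membership.Propositional using (_∈_)
open import Data.List.Membership.Propositional.Properties using (∈-cartesianProduct⁺; ∈-allFin)
open import Data.Product.Base using (Σ; _×_; _,_; ∃; proj₁; proj₂)
open import Data.Sum.Base using ([_,_]′)
open import Data.Vec.Functional using (removeAt; _++_)
open import Data.Rational.Base hiding (NonZero; _≥_)
open import Data.Rational.Properties hiding (_≟_)
import Data.Rational.Properties as ℚ
open import Data.Rational.Solver using (module +-*-Solver)
import Data.Rational.Unnormalised.Base as ℚᵘ
import Data.Rational.Unnormalised.Properties as ℚᵘ
open import Algebra.Bundles using (CommutativeRing)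
open import Algebra.Properties.Semiring.Sum (CommutativeRing.semiring +-*-commutativeRing)
  using (sum; sum-syntax; ∑-distrib-+; *-distribˡ-sum; sum-remove; sum-cong-≗)
open import Relation.Binary.Definitions using (tri<; tri≈; tri>)
open import Relation.Binary.PropositionalEquality
open import Relation.Nullary using (Dec; yes; no; does; proof; ¬_; ¬?; _×-dec_; contradiction)
import Relation.Nullary.Decidable as Dec
open import Relation.Nullary.Reflects using (Reflects; invert)
open import Function.Base using (_∘_)

private
  variable
    k m n q : ℕ

ι : ℕ → ℚ
ι m = + m / 1

-- `_/_` normalises by a gcd, so identities between casts are checked on unnormalised rationals.
ι-+ : ∀ a b → ι (a ℕ.+ b) ≡ ι a + ι b
ι-+ a b = toℚᵘ-injective (begin
  toℚᵘ (ι (a ℕ.+ b))                       ≈⟨ toℚᵘ-fromℚᵘ (ℚᵘ.mkℚᵘ (+ (a ℕ.+ b)) 0) ⟩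
  ℚᵘ.mkℚᵘ (+ (a ℕ.+ b)) 0                  ≈⟨ ℚᵘ.*≡* (solve 2 (λ x y → (x :+ y) :* (con (+ 1) :* con (+ 1)) := (x :* con (+ 1) :+ y :* con (+ 1)) :* con (+ 1)) refl (+ a) (+ b)) ⟩
  ℚᵘ.mkℚᵘ (+ a) 0 ℚᵘ.+ ℚᵘ.mkℚᵘ (+ b) 0     ≈⟨ ℚᵘ.≃-sym (ℚᵘ.+-cong (toℚᵘ-fromℚᵘ (ℚᵘ.mkℚᵘ (+ a) 0)) (toℚᵘ-fromℚᵘ (ℚᵘ.mkℚᵘ (+ b) 0))) ⟩
  toℚᵘ (ι a) ℚᵘ.+ toℚᵘ (ι b)               ≈⟨ ℚᵘ.≃-sym (toℚᵘ-homo-+ (ι a) (ι b)) ⟩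
  toℚᵘ (ι a + ι b)                         ∎)
  where open ℚᵘ.≃-Reasoning
        open ℤ.+-*-Solver

ι-* : ∀ a b → ι (a ℕ.* b) ≡ ι a * ι b
ι-* a b = toℚᵘ-injective (begin
  toℚᵘ (ι (a ℕ.* b))                       ≈⟨ toℚᵘ-fromℚᵘ (ℚᵘ.mkℚᵘ (+ (a ℕ.* b)) 0) ⟩
  ℚᵘ.mkℚᵘ (+ (a ℕ.* b)) 0                  ≈⟨ ℚᵘ.*≡* (trans (cong (ℤ._* (+ 1 ℤ.* + 1)) (ℤ.pos-* a b)) (solve 2 (λ x y → (x :* y) :* (con (+ 1) :* con (+ 1)) := (x :* y) :* con (+ 1)) refl (+ a) (+ b))) ⟩
  ℚᵘ.mkℚᵘ (+ a) 0 ℚᵘ.* ℚᵘ.mkℚᵘ (+ b) 0     ≈⟨ ℚᵘ.≃-sym (ℚᵘ.*-cong (toℚᵘ-fromℚᵘ (ℚᵘ.mkℚᵘ (+ a) 0)) (toℚᵘ-fromℚᵘ (ℚᵘ.mkℚᵘ (+ b) 0))) ⟩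
  toℚᵘ (ι a) ℚᵘ.* toℚᵘ (ι b)               ≈⟨ ℚᵘ.≃-sym (toℚᵘ-homo-* (ι a) (ι b)) ⟩
  toℚᵘ (ι a * ι b)                         ∎)
  where open ℚᵘ.≃-Reasoning
        open ℤ.+-*-Solver

ι*1/ : ∀ q .{{_ : NonZero q}} → ι q * (+ 1 / q) ≡ 1ℚ
ι*1/ (suc q) = toℚᵘ-injective (begin
  toℚᵘ (ι (suc q) * (+ 1 / suc q))                 ≈⟨ toℚᵘ-homo-* (ι (suc q)) (+ 1 / suc q) ⟩
  toℚᵘ (ι (suc q)) ℚᵘ.* toℚᵘ (+ 1 / suc q)         ≈⟨ ℚᵘ.*-cong (toℚᵘ-fromℚᵘ (ℚᵘ.mkℚᵘ (+ suc q) 0)) (toℚᵘ-fromℚᵘ (ℚᵘ.mkℚᵘ (+ 1) q)) ⟩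
  ℚᵘ.mkℚᵘ (+ suc q) 0 ℚᵘ.* ℚᵘ.mkℚᵘ (+ 1) q         ≈⟨ ℚᵘ.*≡* (solve 1 (λ x → (x :* con (+ 1)) :* con (+ 1) := con (+ 1) :* (con (+ 1) :* x)) refl (+ suc q)) ⟩
  ℚᵘ.1ℚᵘ                                           ≈⟨ ℚᵘ.≃-sym (toℚᵘ-fromℚᵘ ℚᵘ.1ℚᵘ) ⟩
  toℚᵘ 1ℚ                                          ∎)
  where open ℚᵘ.≃-Reasoning
        open ℤ.+-*-Solver

0<1 : 0ℚ < 1ℚ
0<1 = *<* (+<+ (s≤s z≤n))

ι<ι-suc : ∀ m → ι m < ι (suc m)
ι<ι-suc m = begin-strict
  ι m         ≡⟨ +-identityˡ (ι m) ⟨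
  0ℚ + ι m    <⟨ +-monoˡ-< (ι m) 0<1 ⟩
  1ℚ + ι m    ≡⟨ ι-+ 1 m ⟨
  ι (suc m)   ∎
  where open ≤-Reasoning

ι-nonneg : ∀ m → 0ℚ ≤ ι m
ι-nonneg zero    = ≤-refl
ι-nonneg (suc m) = <⇒≤ (≤-<-trans (ι-nonneg m) (ι<ι-suc m))

+-cancelˡ-< : ∀ x {y z} → x + y < x + z → y < z
+-cancelˡ-< x {y} {z} x+y<x+z = ≰⇒> (λ z≤y → <-irrefl refl (<-≤-trans x+y<x+z (+-monoʳ-≤ x z≤y)))

+-cancelˡ-≤ : ∀ x {y z} → x + y ≤ x + z → y ≤ z
+-cancelˡ-≤ x {y} {z} x+y≤x+z = ≮⇒≥ (λ z<y → <-irrefl refl (≤-<-trans x+y≤x+z (+-monoʳ-< x z<y)))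

*-nonneg : ∀ {a b} → 0ℚ ≤ a → 0ℚ ≤ b → 0ℚ ≤ a * b
*-nonneg {a} {b} 0≤a 0≤b = nonNegative⁻¹ (a * b) {{nonNeg*nonNeg⇒nonNeg a {{nonNegative 0≤a}} b {{nonNegative 0≤b}}}}

*-≢0 : ∀ {a b} → a ≢ 0ℚ → b ≢ 0ℚ → a * b ≢ 0ℚ
*-≢0 {a} {b} a≢0 b≢0 ab≡0 = b≢0 (begin
  b                  ≡⟨ *-identityˡ b ⟨
  1ℚ * b             ≡⟨ cong (_* b) (*-inverseˡ a) ⟨
  (1/ a) * a * b     ≡⟨ *-assoc (1/ a) a b ⟩
  (1/ a) * (a * b)   ≡⟨ cong ((1/ a) *_) ab≡0 ⟩
  (1/ a) * 0ℚ        ≡⟨ *-zeroʳ (1/ a) ⟩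
  0ℚ                 ∎)
  where open ≡-Reasoning
        instance _ = ≢-nonZero a≢0

∀-++ : ∀ {A : Set} {P : A → Set} (f : Fin m → A) (g : Fin k → A) →
       (∀ r → P ((f ++ g) r)) → (∀ i → P (f i)) × (∀ j → P (g j))
∀-++ {m} {k} {P = P} f g all =
  (λ i → subst P (cong [ f , g ]′ (splitAt-↑ˡ m i k)) (all (i ↑ˡ k))) ,
  (λ j → subst P (cong [ f , g ]′ (splitAt-↑ʳ m k j)) (all (m ↑ʳ j)))

-- Finite sums

∑-mono-≤ : ∀ {f g : Fin n → ℚ} → (∀ i → f i ≤ g i) → ∑[ i < n ] f i ≤ ∑[ i < n ] g i
∑-mono-≤ {zero}  f≤g = ≤-refl
∑-mono-≤ {suc n} f≤g = +-mono-≤ (f≤g zero) (∑-mono-≤ (f≤g ∘ suc))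

∑-mono-< : ∀ {f g : Fin n → ℚ} → (∀ i → f i ≤ g i) → ∀ j → f j < g j → ∑[ i < n ] f i < ∑[ i < n ] g i
∑-mono-< f≤g zero    fj<gj = +-mono-<-≤ fj<gj (∑-mono-≤ (f≤g ∘ suc))
∑-mono-< f≤g (suc j) fj<gj = +-mono-≤-< (f≤g zero) (∑-mono-< (f≤g ∘ suc) j fj<gj)

∑-zero : ∀ n → ∑[ i < n ] 0ℚ ≡ 0ℚ
∑-zero zero    = refl
∑-zero (suc n) = trans (+-identityˡ _) (∑-zero n)

∑-nonneg : ∀ {f : Fin n → ℚ} → (∀ i → 0ℚ ≤ f i) → 0ℚ ≤ ∑[ i < n ] f i
∑-nonneg {n} {f} 0≤f = subst (_≤ ∑[ i < n ] f i) (∑-zero n) (∑-mono-≤ {f = λ _ → 0ℚ} 0≤f)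

∑-const : ∀ n x → ∑[ i < n ] x ≡ ι n * x
∑-const zero    x = sym (*-zeroˡ x)
∑-const (suc n) x = begin
  x + ∑[ i < n ] x     ≡⟨ cong (_+_ x) (∑-const n x) ⟩
  x + ι n * x          ≡⟨ cong (_+ ι n * x) (*-identityˡ x) ⟨
  1ℚ * x + ι n * x     ≡⟨ *-distribʳ-+ x 1ℚ (ι n) ⟨
  (1ℚ + ι n) * x       ≡⟨ cong (_* x) (ι-+ 1 n) ⟨
  ι (suc n) * x        ∎
  where open ≡-Reasoning

∑-distrib-- : ∀ (f g : Fin n → ℚ) → ∑[ i < n ] (f i - g i) ≡ ∑[ i < n ] f i - ∑[ i < n ] g i
∑-distrib-- {zero}  f g = refl
∑-distrib-- {suc n} f g = begin
  (f zero - g zero) + ∑[ i < n ] (f (suc i) - g (suc i))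
    ≡⟨ cong (_+_ (f zero - g zero)) (∑-distrib-- (f ∘ suc) (g ∘ suc)) ⟩
  (f zero - g zero) + (∑[ i < n ] f (suc i) - ∑[ i < n ] g (suc i))
    ≡⟨ solve 4 (λ a b c d → (a :- b) :+ (c :- d) := (a :+ c) :- (b :+ d)) refl (f zero) (g zero) _ _ ⟩
  (f zero + ∑[ i < n ] f (suc i)) - (g zero + ∑[ i < n ] g (suc i))  ∎
  where open ≡-Reasoning
        open +-*-Solver

∣∑∣≤∑∣∣ : ∀ (f : Fin n → ℚ) → ∣ ∑[ i < n ] f i ∣ ≤ ∑[ i < n ] ∣ f i ∣
∣∑∣≤∑∣∣ {zero}  f = ≤-refl
∣∑∣≤∑∣∣ {suc n} f = ≤-trans (∣p+q∣≤∣p∣+∣q∣ (f zero) _) (+-monoʳ-≤ ∣ f zero ∣ (∣∑∣≤∑∣∣ (f ∘ suc)))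

term≤∑ : ∀ {f : Fin n → ℚ} → (∀ i → 0ℚ ≤ f i) → ∀ i → f i ≤ ∑[ j < n ] f j
term≤∑ {suc n} {f} 0≤f i = begin
  f i                        ≡⟨ +-identityʳ (f i) ⟨
  f i + 0ℚ                   ≤⟨ +-monoʳ-≤ (f i) (∑-nonneg (0≤f ∘ punchIn i)) ⟩
  f i + sum (removeAt f i)   ≡⟨ sum-remove f ⟨
  sum f                      ∎
  where open ≤-Reasoning

pair≤∑ : ∀ {f : Fin n → ℚ} → (∀ i → 0ℚ ≤ f i) → ∀ {i j} → i ≢ j → f i + f j ≤ ∑[ k < n ] f k
pair≤∑ {suc n} {f} 0≤f {i} {j} i≢j = begin
  f i + f j                  ≡⟨ cong (λ k → f i + f k) (punchIn-punchOut i≢j) ⟨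
  f i + removeAt f i j′      ≤⟨ +-monoʳ-≤ (f i) (term≤∑ (0≤f ∘ punchIn i) j′) ⟩
  f i + sum (removeAt f i)   ≡⟨ sum-remove f ⟨
  sum f                      ∎
  where open ≤-Reasoning
        j′ : Fin n
        j′ = punchOut i≢j

∑-pos⇒pos : ∀ (f : Fin n → ℚ) → 0ℚ < ∑[ i < n ] f i → ∃ λ i → 0ℚ < f i
∑-pos⇒pos {n} f 0<∑f with any? (λ i → 0ℚ <? f i)
... | yes pos = pos
... | no ¬pos = contradiction (<-≤-trans 0<∑f ∑f≤0) (<-irrefl refl)
  where
  ∑f≤0 : ∑[ i < n ] f i ≤ 0ℚ
  ∑f≤0 = subst (∑[ i < n ] f i ≤_) (∑-zero n) (∑-mono-≤ (λ i → ≮⇒≥ (¬pos ∘ (i ,_))))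

term<∑⇒other-pos : ∀ (f : Fin n → ℚ) i → f i < ∑[ j < n ] f j → ∃ λ j → j ≢ i × 0ℚ < f j
term<∑⇒other-pos {suc n} f i fi<∑f with ∑-pos⇒pos (removeAt f i) 0<rest
  where
  0<rest : 0ℚ < sum (removeAt f i)
  0<rest = +-cancelˡ-< (f i) (begin-strict
    f i + 0ℚ                  ≡⟨ +-identityʳ (f i) ⟩
    f i                       <⟨ fi<∑f ⟩
    sum f                     ≡⟨ sum-remove f ⟩
    f i + sum (removeAt f i)  ∎)
    where open ≤-Reasoning
... | j , 0<fj = punchIn i j , punchInᵢ≢i i j , 0<fj

∑≡0⇒neg : ∀ (f : Fin n → ℚ) → ∑[ i < n ] f i ≡ 0ℚ → ∀ i → 0ℚ < f i → ∃ λ j → f j < 0ℚ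
∑≡0⇒neg f ∑f≡0 i 0<fi with any? (λ j → f j <? 0ℚ)
... | yes neg = neg
... | no ¬neg = contradiction (≤-<-trans (subst (f i ≤_) ∑f≡0 (term≤∑ (λ j → ≮⇒≥ (¬neg ∘ (j ,_))) i)) 0<fi) (<-irrefl refl)

⟦_⟧ : Bool → ℚ
⟦ b ⟧ = if b then 1ℚ else 0ℚ

⟦⟧-nonneg : ∀ b → 0ℚ ≤ ⟦ b ⟧
⟦⟧-nonneg true  = <⇒≤ 0<1
⟦⟧-nonneg false = ≤-refl

δ : Fin n → Fin n → ℚ
δ i j = ⟦ does (i ≟ j) ⟧

δ-refl : ∀ (i : Fin n) → δ i i ≡ 1ℚ
δ-refl i = cong ⟦_⟧ (Dec.dec-true (i ≟ i) refl)

∑-δ : ∀ (i : Fin n) (f : Fin n → ℚ) → ∑[ j < n ] (δ i j * f j) ≡ f i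
∑-δ {suc n} zero    f = begin
  1ℚ * f zero + ∑[ j < n ] (0ℚ * f (suc j))  ≡⟨ cong₂ _+_ (*-identityˡ (f zero)) (sum-cong-≗ (*-zeroˡ ∘ f ∘ suc)) ⟩
  f zero + ∑[ j < n ] 0ℚ                     ≡⟨ cong (_+_ (f zero)) (∑-zero n) ⟩
  f zero + 0ℚ                                ≡⟨ +-identityʳ (f zero) ⟩
  f zero                                     ∎
  where open ≡-Reasoning
∑-δ {suc n} (suc i) f = begin
  0ℚ * f zero + ∑[ j < n ] (δ i j * f (suc j))  ≡⟨ cong (_+ ∑[ j < n ] (δ i j * f (suc j))) (*-zeroˡ (f zero)) ⟩
  0ℚ + ∑[ j < n ] (δ i j * f (suc j))           ≡⟨ +-identityˡ _ ⟩
  ∑[ j < n ] (δ i j * f (suc j))                ≡⟨ ∑-δ i (f ∘ suc) ⟩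
  f (suc i)                                     ∎
  where open ≡-Reasoning

-- Linear algebra on ℚ-vectors indexed by positions (t , c) ∈ Fin n × Fin q

∑ₚ : (Fin n × Fin q → ℚ) → ℚ
∑ₚ {n} {q} f = ∑[ t < n ] ∑[ c < q ] f (t , c)

∑ₚ-cong : ∀ {f g : Fin n × Fin q → ℚ} → (∀ p → f p ≡ g p) → ∑ₚ f ≡ ∑ₚ g
∑ₚ-cong f≡g = sum-cong-≗ (λ t → sum-cong-≗ (λ c → f≡g (t , c)))

∑ₚ-mono-≤ : ∀ {f g : Fin n × Fin q → ℚ} → (∀ p → f p ≤ g p) → ∑ₚ f ≤ ∑ₚ g
∑ₚ-mono-≤ f≤g = ∑-mono-≤ (λ t → ∑-mono-≤ (λ c → f≤g (t , c)))

∑ₚ-zero : ∀ {f : Fin n × Fin q → ℚ} → (∀ p → f p ≡ 0ℚ) → ∑ₚ f ≡ 0ℚ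
∑ₚ-zero {n} {q} f≡0 = trans (∑ₚ-cong f≡0) (trans (sum-cong-≗ {n} (λ _ → ∑-zero q)) (∑-zero n))

∑ₚ-distrib-+ : ∀ (f g : Fin n × Fin q → ℚ) → ∑ₚ (λ p → f p + g p) ≡ ∑ₚ f + ∑ₚ g
∑ₚ-distrib-+ {n} {q} f g = trans (sum-cong-≗ (λ t → ∑-distrib-+ (λ c → f (t , c)) (λ c → g (t , c))))
                                 (∑-distrib-+ (λ t → ∑[ c < q ] f (t , c)) (λ t → ∑[ c < q ] g (t , c)))

∑ₚ-*ˡ : ∀ z (f : Fin n × Fin q → ℚ) → ∑ₚ (λ p → z * f p) ≡ z * ∑ₚ f
∑ₚ-*ˡ {n} {q} z f = trans (sum-cong-≗ (λ t → sym (*-distribˡ-sum z (λ c → f (t , c)))))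
                          (sym (*-distribˡ-sum z (λ t → ∑[ c < q ] f (t , c))))

∑ₚ-linear : ∀ x y (f g : Fin n × Fin q → ℚ) → ∑ₚ (λ p → x * f p + y * g p) ≡ x * ∑ₚ f + y * ∑ₚ g
∑ₚ-linear x y f g = trans (∑ₚ-distrib-+ (λ p → x * f p) (λ p → y * g p)) (cong₂ _+_ (∑ₚ-*ˡ x f) (∑ₚ-*ˡ y g))

⟨_,_⟩ : (a x : Fin n × Fin q → ℚ) → ℚ
⟨ a , x ⟩ = ∑ₚ (λ p → a p * x p)

⟨⟩-linearʳ : ∀ (a : Fin n × Fin q → ℚ) x y f g → ⟨ a , (λ p → x * f p + y * g p) ⟩ ≡ x * ⟨ a , f ⟩ + y * ⟨ a , g ⟩
⟨⟩-linearʳ a x y f g =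
  trans (∑ₚ-cong λ p → solve 5 (λ A X Y F G → A :* (X :* F :+ Y :* G) := X :* (A :* F) :+ Y :* (A :* G)) refl (a p) x y (f p) (g p))
        (∑ₚ-linear x y (λ p → a p * f p) (λ p → a p * g p))
  where open +-*-Solver

⟨⟩-linearˡ : ∀ (b : Fin n × Fin q → ℚ) x y f g → ⟨ (λ p → x * f p + y * g p) , b ⟩ ≡ x * ⟨ f , b ⟩ + y * ⟨ g , b ⟩
⟨⟩-linearˡ b x y f g =
  trans (∑ₚ-cong λ p → solve 5 (λ B X Y F G → (X :* F :+ Y :* G) :* B := X :* (F :* B) :+ Y :* (G :* B)) refl (b p) x y (f p) (g p))
        (∑ₚ-linear x y (λ p → f p * b p) (λ p → g p * b p))
  where open +-*-Solver

⟨⟩-along : ∀ (a x y : Fin n × Fin q → ℚ) s → ⟨ a , (λ p → x p + s * y p) ⟩ ≡ ⟨ a , x ⟩ + s * ⟨ a , y ⟩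
⟨⟩-along a x y s = begin
  ⟨ a , (λ p → x p + s * y p) ⟩          ≡⟨ ∑ₚ-cong (λ p → cong (λ e → a p * (e + s * y p)) (*-identityˡ (x p))) ⟨
  ⟨ a , (λ p → 1ℚ * x p + s * y p) ⟩     ≡⟨ ⟨⟩-linearʳ a 1ℚ s x y ⟩
  1ℚ * ⟨ a , x ⟩ + s * ⟨ a , y ⟩         ≡⟨ cong (_+ s * ⟨ a , y ⟩) (*-identityˡ ⟨ a , x ⟩) ⟩
  ⟨ a , x ⟩ + s * ⟨ a , y ⟩              ∎
  where open ≡-Reasoning

⟨⟩-along-⊥ : ∀ (a x y : Fin n × Fin q → ℚ) s → ⟨ a , y ⟩ ≡ 0ℚ → ⟨ a , (λ p → x p + s * y p) ⟩ ≡ ⟨ a , x ⟩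
⟨⟩-along-⊥ a x y s a⊥y = begin
  ⟨ a , (λ p → x p + s * y p) ⟩    ≡⟨ ⟨⟩-along a x y s ⟩
  ⟨ a , x ⟩ + s * ⟨ a , y ⟩        ≡⟨ cong (λ e → ⟨ a , x ⟩ + s * e) a⊥y ⟩
  ⟨ a , x ⟩ + s * 0ℚ               ≡⟨ cong (_+_ ⟨ a , x ⟩) (*-zeroʳ s) ⟩
  ⟨ a , x ⟩ + 0ℚ                   ≡⟨ +-identityʳ ⟨ a , x ⟩ ⟩
  ⟨ a , x ⟩                        ∎
  where open ≡-Reasoning

𝟙 : Fin n × Fin q → Fin n × Fin q → ℚ
𝟙 (t₀ , c₀) (t , c) = δ t₀ t * δ c₀ c

𝟙-diag : ∀ (p : Fin n × Fin q) → 𝟙 p p ≡ 1ℚ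
𝟙-diag (t , c) = cong₂ _*_ (δ-refl t) (δ-refl c)

𝟙-≢ : ∀ {p p′ : Fin n × Fin q} → p ≢ p′ → 𝟙 p p′ ≡ 0ℚ
𝟙-≢ {p = t₀ , c₀} {t , c} p≢p′ with t₀ ≟ t | c₀ ≟ c
... | yes refl | yes refl = contradiction refl p≢p′
... | yes _    | no _     = refl
... | no _     | yes _    = refl
... | no _     | no _     = refl

⟨-,𝟙⟩ : ∀ (a : Fin n × Fin q → ℚ) p → ⟨ a , 𝟙 p ⟩ ≡ a p
⟨-,𝟙⟩ {n} {q} a (t₀ , c₀) = begin
  ∑[ t < n ] ∑[ c < q ] (a (t , c) * (δ t₀ t * δ c₀ c))
    ≡⟨ sum-cong-≗ (λ t → trans (sum-cong-≗ (λ c → solve 3 (λ A X Y → A :* (X :* Y) := X :* (Y :* A)) refl (a (t , c)) (δ t₀ t) (δ c₀ c)))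
                                 (sym (*-distribˡ-sum (δ t₀ t) (λ c → δ c₀ c * a (t , c))))) ⟩
  ∑[ t < n ] (δ t₀ t * ∑[ c < q ] (δ c₀ c * a (t , c)))
    ≡⟨ sum-cong-≗ (λ t → cong (δ t₀ t *_) (∑-δ c₀ (λ c → a (t , c)))) ⟩
  ∑[ t < n ] (δ t₀ t * a (t , c₀))
    ≡⟨ ∑-δ t₀ (λ t → a (t , c₀)) ⟩
  a (t₀ , c₀)  ∎
  where open ≡-Reasoning
        open +-*-Solver

rowχ : Fin n → Fin n × Fin q → ℚ
rowχ t₀ (t , c) = δ t₀ t

⟨rowχ,-⟩ : ∀ t₀ (x : Fin n × Fin q → ℚ) → ⟨ rowχ t₀ , x ⟩ ≡ ∑[ c < q ] x (t₀ , c)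
⟨rowχ,-⟩ {n} {q} t₀ x = begin
  ∑[ t < n ] ∑[ c < q ] (δ t₀ t * x (t , c))   ≡⟨ sum-cong-≗ (λ t → sym (*-distribˡ-sum (δ t₀ t) (λ c → x (t , c)))) ⟩
  ∑[ t < n ] (δ t₀ t * ∑[ c < q ] x (t , c))   ≡⟨ ∑-δ t₀ (λ t → ∑[ c < q ] x (t , c)) ⟩
  ∑[ c < q ] x (t₀ , c)                        ∎
  where open ≡-Reasoning

χ : Vertex n q → Fin n × Fin q → ℚ
χ u (t , c) = δ (u t) c

⟨χ,-⟩ : ∀ (u : Vertex n q) x → ⟨ χ u , x ⟩ ≡ ∑[ t < n ] x (t , u t)
⟨χ,-⟩ u x = sum-cong-≗ (λ t → ∑-δ (u t) (λ c → x (t , c)))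

supp : (Fin n × Fin q → ℚ) → Fin n × Fin q → Bool
supp x p = does (0ℚ <? x p)

∈-supp⁺ : ∀ {x : Fin n × Fin q → ℚ} {p} → 0ℚ < x p → supp x p ≡ true
∈-supp⁺ {x = x} {p} = Dec.dec-true (0ℚ <? x p)

∈-supp⁻ : ∀ {x : Fin n × Fin q → ℚ} {p} → supp x p ≡ true → 0ℚ < x p
∈-supp⁻ {x = x} {p} eq = invert (subst (Reflects _) eq (proof (0ℚ <? x p)))

∉-supp⁻ : ∀ {x : Fin n × Fin q → ℚ} {p} → supp x p ≡ false → x p ≤ 0ℚ
∉-supp⁻ {x = x} {p} eq = ≮⇒≥ (invert (subst (Reflects _) eq (proof (0ℚ <? x p))))

_⊆_ : (M M′ : Fin n × Fin q → Bool) → Set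
M ⊆ M′ = ∀ p → M p ≡ true → M′ p ≡ true

count : (Fin n × Fin q → Bool) → ℚ
count M = ∑ₚ (λ p → ⟦ M p ⟧)

_─_ : (Fin n × Fin q → Bool) → Fin n × Fin q → Fin n × Fin q → Bool
(M ─ (t₀ , c₀)) (t , c) = M (t , c) ∧ not (does (t₀ ≟ t) ∧ does (c₀ ≟ c))

─-removes : ∀ (M : Fin n × Fin q → Bool) p → (M ─ p) p ≡ false
─-removes M (t , c) with t ≟ t | c ≟ c
... | yes _   | yes _   = Bool.∧-zeroʳ (M (t , c))
... | no t≢t  | _       = contradiction refl t≢t
... | yes _   | no c≢c  = contradiction refl c≢c

count-remove : ∀ (M : Fin n × Fin q → Bool) p → M p ≡ true → count M ≡ 1ℚ + count (M ─ p)
count-remove M p@(t₀ , c₀) Mp = begin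
  count M                               ≡⟨ ∑ₚ-cong split ⟩
  ∑ₚ (λ p′ → 𝟙 p p′ + ⟦ (M ─ p) p′ ⟧)  ≡⟨ ∑ₚ-distrib-+ (𝟙 p) (λ p′ → ⟦ (M ─ p) p′ ⟧) ⟩
  ∑ₚ (𝟙 p) + count (M ─ p)              ≡⟨ cong (_+ count (M ─ p)) ∑ₚ𝟙 ⟩
  1ℚ + count (M ─ p)                    ∎
  where
  open ≡-Reasoning
  ∑ₚ𝟙 : ∑ₚ (𝟙 p) ≡ 1ℚ
  ∑ₚ𝟙 = trans (∑ₚ-cong (λ p′ → sym (*-identityˡ (𝟙 p p′)))) (⟨-,𝟙⟩ (λ _ → 1ℚ) p)
  split : ∀ p′ → ⟦ M p′ ⟧ ≡ 𝟙 p p′ + ⟦ (M ─ p) p′ ⟧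
  split (t , c) = aux
    where
    keep : ∀ b → ⟦ b ⟧ ≡ 0ℚ + ⟦ b ∧ true ⟧
    keep true  = refl
    keep false = refl
    aux : ⟦ M (t , c) ⟧ ≡ ⟦ does (t₀ ≟ t) ⟧ * ⟦ does (c₀ ≟ c) ⟧ + ⟦ M (t , c) ∧ not (does (t₀ ≟ t) ∧ does (c₀ ≟ c)) ⟧
    aux with t₀ ≟ t | c₀ ≟ c
    ... | yes refl | yes refl rewrite Mp = refl
    ... | yes _    | no _     = keep (M (t , c))
    ... | no _     | yes _    = keep (M (t , c))
    ... | no _     | no _     = keep (M (t , c))

count-mono : ∀ {M M′ : Fin n × Fin q → Bool} → M ⊆ M′ → count M ≤ count M′
count-mono {M = M} {M′} M⊆M′ = ∑ₚ-mono-≤ pointwise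
  where
  pointwise : ∀ p → ⟦ M p ⟧ ≤ ⟦ M′ p ⟧
  pointwise p with M p in eq
  ... | true  rewrite M⊆M′ p eq = ≤-refl
  ... | false = ⟦⟧-nonneg (M′ p)

count-pos⇒nonempty : ∀ (M : Fin n × Fin q → Bool) → 0ℚ < count M → ∃ λ p → M p ≡ true
count-pos⇒nonempty M 0<count with ∑-pos⇒pos _ 0<count
... | t , 0<row with ∑-pos⇒pos _ 0<row
... | c , 0<⟦M⟧ = (t , c) , ⟦⟧-pos 0<⟦M⟧
  where
  ⟦⟧-pos : ∀ {b} → 0ℚ < ⟦ b ⟧ → b ≡ true
  ⟦⟧-pos {true}  _   = refl
  ⟦⟧-pos {false} 0<0 = contradiction 0<0 (<-irrefl refl)

count-⊂ : ∀ {M M′ : Fin n × Fin q → Bool} {j} → M ⊆ M′ → M′ j ≡ true → M j ≡ false → 1ℚ + count M ≤ count M′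
count-⊂ {M = M} {M′} {j@(t₀ , c₀)} M⊆M′ M′j Mj = begin
  1ℚ + count M          ≤⟨ +-monoʳ-≤ 1ℚ (count-mono M⊆M′─j) ⟩
  1ℚ + count (M′ ─ j)   ≡⟨ count-remove M′ j M′j ⟨
  count M′              ∎
  where
  open ≤-Reasoning
  M⊆M′─j : M ⊆ (M′ ─ j)
  M⊆M′─j (t , c) Mp = aux
    where
    aux : M′ (t , c) ∧ not (does (t₀ ≟ t) ∧ does (c₀ ≟ c)) ≡ true
    aux with t₀ ≟ t | c₀ ≟ c
    ... | yes refl | yes refl = contradiction (trans (sym Mj) Mp) λ ()
    ... | yes _    | no _     rewrite M⊆M′ (t , c) Mp = refl
    ... | no _     | _        rewrite M⊆M′ (t , c) Mp = refl

count≤n*q : ∀ (M : Fin n × Fin q → Bool) → count M ≤ ι (n ℕ.* q)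
count≤n*q {n} {q} M = begin
  count M                          ≤⟨ ∑ₚ-mono-≤ (λ p → ⟦⟧≤1 (M p)) ⟩
  ∑[ t < n ] ∑[ c < q ] 1ℚ         ≡⟨ sum-cong-≗ {n} (λ _ → ∑-const q 1ℚ) ⟩
  ∑[ t < n ] (ι q * 1ℚ)            ≡⟨ ∑-const n (ι q * 1ℚ) ⟩
  ι n * (ι q * 1ℚ)                 ≡⟨ cong (ι n *_) (*-identityʳ (ι q)) ⟩
  ι n * ι q                        ≡⟨ ι-* n q ⟨
  ι (n ℕ.* q)                      ∎
  where
  open ≤-Reasoning
  ⟦⟧≤1 : ∀ b → ⟦ b ⟧ ≤ 1ℚ
  ⟦⟧≤1 true  = ≤-refl
  ⟦⟧≤1 false = <⇒≤ 0<1

record NonTrivialSolution (rows : Fin m → Fin n × Fin q → ℚ) (M : Fin n × Fin q → Bool) : Set where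
  field
    vec     : Fin n × Fin q → ℚ
    nonzero : ∃ λ p → vec p ≢ 0ℚ
    supported  : ∀ p → M p ≡ false → vec p ≡ 0ℚ
    solves  : ∀ r → ⟨ rows r , vec ⟩ ≡ 0ℚ

eliminated : (rows : Fin (suc m) → Fin n × Fin q → ℚ) → Fin n × Fin q → Fin m → Fin n × Fin q → ℚ
eliminated rows p r p′ = rows zero p * rows (suc r) p′ + (- rows (suc r) p) * rows zero p′

-- The eliminated rows do not involve the unknown at p; its value is chosen afterwards so as to
-- satisfy the first equation.
eliminate : ∀ (rows : Fin (suc m) → Fin n × Fin q → ℚ) M p → M p ≡ true → rows zero p ≢ 0ℚ →
            NonTrivialSolution (eliminated rows p) (M ─ p) → NonTrivialSolution rows M
eliminate rows M p Mp a≢0 sol = record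
  { vec     = x
  ; nonzero = nonzero′ nonzero
  ; supported  = supported′
  ; solves  = solves′
  }
  where
  open NonTrivialSolution sol renaming (vec to x′)
  a X : ℚ
  a = rows zero p
  X = ⟨ rows zero , x′ ⟩
  x : Fin _ × Fin _ → ℚ
  x p′ = a * x′ p′ + (- X) * 𝟙 p p′
  nonzero′ : (∃ λ p′ → x′ p′ ≢ 0ℚ) → ∃ λ p′ → x p′ ≢ 0ℚ
  nonzero′ (p′ , x′≢0) = p′ , λ x≡0 → *-≢0 a≢0 x′≢0 (begin
    a * x′ p′                    ≡⟨ +-identityʳ (a * x′ p′) ⟨
    a * x′ p′ + 0ℚ               ≡⟨ cong (_+_ (a * x′ p′)) (*-zeroʳ (- X)) ⟨
    a * x′ p′ + (- X) * 0ℚ       ≡⟨ cong (λ e → a * x′ p′ + (- X) * e) (𝟙-≢ p≢p′) ⟨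
    x p′                         ≡⟨ x≡0 ⟩
    0ℚ                           ∎)
    where
    open ≡-Reasoning
    p≢p′ : p ≢ p′
    p≢p′ refl = x′≢0 (supported p (─-removes M p))
  supported′ : ∀ p′ → M p′ ≡ false → x p′ ≡ 0ℚ
  supported′ p′ Mp′ = begin
    a * x′ p′ + (- X) * 𝟙 p p′   ≡⟨ cong₂ (λ u v → a * u + (- X) * v) (supported p′ (cong (_∧ _) Mp′))
                                          (𝟙-≢ {p = p} {p′} λ { refl → contradiction (trans (sym Mp) Mp′) λ () }) ⟩
    a * 0ℚ + (- X) * 0ℚ          ≡⟨ cong₂ _+_ (*-zeroʳ a) (*-zeroʳ (- X)) ⟩
    0ℚ                           ∎
    where open ≡-Reasoning
  solves′ : ∀ r → ⟨ rows r , x ⟩ ≡ 0ℚ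
  solves′ zero = begin
    ⟨ rows zero , x ⟩                     ≡⟨ ⟨⟩-linearʳ (rows zero) a (- X) x′ (𝟙 p) ⟩
    a * X + (- X) * ⟨ rows zero , 𝟙 p ⟩  ≡⟨ cong (λ e → a * X + (- X) * e) (⟨-,𝟙⟩ (rows zero) p) ⟩
    a * X + (- X) * a                     ≡⟨ solve 2 (λ A Y → A :* Y :+ (:- Y) :* A := con 0ℚ) refl a X ⟩
    0ℚ                                    ∎
    where open ≡-Reasoning
          open +-*-Solver
  solves′ (suc r) = begin
    ⟨ rows (suc r) , x ⟩                       ≡⟨ ⟨⟩-linearʳ (rows (suc r)) a (- X) x′ (𝟙 p) ⟩
    a * Y + (- X) * ⟨ rows (suc r) , 𝟙 p ⟩     ≡⟨ cong (λ e → a * Y + (- X) * e) (⟨-,𝟙⟩ (rows (suc r)) p) ⟩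
    a * Y + (- X) * b                          ≡⟨ solve 4 (λ A Y X B → A :* Y :+ (:- X) :* B := A :* Y :+ (:- B) :* X) refl a Y X b ⟩
    a * Y + (- b) * X                          ≡⟨ ⟨⟩-linearˡ x′ a (- b) (rows (suc r)) (rows zero) ⟨
    ⟨ eliminated rows p r , x′ ⟩               ≡⟨ solves r ⟩
    0ℚ                                         ∎
    where open ≡-Reasoning
          open +-*-Solver
          Y b : ℚ
          Y = ⟨ rows (suc r) , x′ ⟩
          b = rows (suc r) p

skipVanishingRow : ∀ (rows : Fin (suc m) → Fin n × Fin q → ℚ) M → (∀ p → M p ≡ true → rows zero p ≡ 0ℚ) →
                   NonTrivialSolution (rows ∘ suc) M → NonTrivialSolution rows M
skipVanishingRow rows M vanishing sol = record
  { vec     = vec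
  ; nonzero = nonzero
  ; supported  = supported
  ; solves  = λ { zero → ∑ₚ-zero r₀x≡0 ; (suc r) → solves r }
  }
  where
  open NonTrivialSolution sol
  r₀x≡0 : ∀ p → rows zero p * vec p ≡ 0ℚ
  r₀x≡0 p = byMembership (M p) refl
    where
    byMembership : ∀ b → M p ≡ b → rows zero p * vec p ≡ 0ℚ
    byMembership false Mp = trans (cong (rows zero p *_) (supported p Mp)) (*-zeroʳ (rows zero p))
    byMembership true  Mp = trans (cong (_* vec p) (vanishing p Mp)) (*-zeroˡ (vec p))

nonTrivialSolution : ∀ m (rows : Fin m → Fin n × Fin q → ℚ) M → ι m < count M → NonTrivialSolution rows M
nonTrivialSolution zero rows M 0<count with count-pos⇒nonempty M 0<count
... | p , Mp = record
  { vec     = 𝟙 p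
  ; nonzero = p , λ 𝟙pp≡0 → 1≢0 (trans (sym (𝟙-diag p)) 𝟙pp≡0)
  ; supported  = λ p′ Mp′ → 𝟙-≢ {p = p} {p′} λ { refl → contradiction (trans (sym Mp) Mp′) λ () }
  ; solves  = λ ()
  }
nonTrivialSolution (suc m) rows M m<count =
  [ (λ { (t , c , Mp , a≢0) → eliminate rows M (t , c) Mp a≢0 (nonTrivialSolution m _ _ (fewer (t , c) Mp)) })
  , (λ noPivot → skipVanishingRow rows M (vanishing noPivot) (nonTrivialSolution m _ _ (<-trans (ι<ι-suc m) m<count)))
  ]′ (Dec.toSum (any? (λ t → any? (λ c → (M (t , c) Bool.≟ true) ×-dec ¬? (rows zero (t , c) ℚ.≟ 0ℚ)))))
  where
  fewer : ∀ p → M p ≡ true → ι m < count (M ─ p)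
  fewer p Mp = +-cancelˡ-< 1ℚ (subst₂ _<_ (ι-+ 1 m) (count-remove M p Mp) m<count)
  vanishing : ¬ (∃ λ t → ∃ λ c → M (t , c) ≡ true × rows zero (t , c) ≢ 0ℚ) → ∀ p → M p ≡ true → rows zero p ≡ 0ℚ
  vanishing noPivot (t , c) Mp = Dec.decidable-stable (rows zero (t , c) ℚ.≟ 0ℚ) (λ r≢0 → noPivot (t , c , Mp , r≢0))

zeroAt : (a b : ℚ) → b < 0ℚ → ℚ
zeroAt a b b<0 = a * (1/ (- b)) {{>-nonZero (neg-antimono-< b<0)}}

zeroAt-vanishes : ∀ a b (b<0 : b < 0ℚ) → a + zeroAt a b b<0 * b ≡ 0ℚ
zeroAt-vanishes a b b<0 = begin
  a + a * r * b              ≡⟨ cong (_+_ a) (solve 3 (λ A R B → A :* R :* B := :- (A :* (R :* (:- B)))) refl a r b) ⟩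
  a + - (a * (r * (- b)))    ≡⟨ cong (λ e → a + - (a * e)) (*-inverseˡ (- b) {{>-nonZero (neg-antimono-< b<0)}}) ⟩
  a + - (a * 1ℚ)             ≡⟨ cong (λ e → a + - e) (*-identityʳ a) ⟩
  a + - a                    ≡⟨ +-inverseʳ a ⟩
  0ℚ                         ∎
  where open ≡-Reasoning
        open +-*-Solver
        r = (1/ (- b)) {{>-nonZero (neg-antimono-< b<0)}}

zeroAt-nonneg : ∀ {a b} (b<0 : b < 0ℚ) → 0ℚ ≤ a → 0ℚ ≤ zeroAt a b b<0
zeroAt-nonneg {a} {b} b<0 0≤a = *-nonneg 0≤a (<⇒≤ (positive⁻¹ _ {{1/pos⇒pos (- b) {{positive (neg-antimono-< b<0)}}}}))

module _ {I : Set} (x d : I → ℚ) (x≥0 : ∀ i → 0ℚ ≤ x i) where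

  record Boundary : Set where
    field
      step     : ℚ
      step≥0   : 0ℚ ≤ step
      tight    : I
      tight<0  : d tight < 0ℚ
      vanishes : x tight + step * d tight ≡ 0ℚ

  open Boundary

  private
    grows : ∀ {s} i → 0ℚ ≤ s → 0ℚ ≤ d i → 0ℚ ≤ x i + s * d i
    grows {s} i 0≤s 0≤di = ≤-trans (x≥0 i) (subst (_≤ x i + s * d i) (+-identityʳ (x i)) (+-monoʳ-≤ (x i) (*-nonneg 0≤s 0≤di)))

    shorter-step : ∀ {s s′} i → 0ℚ ≤ s′ → s′ ≤ s → 0ℚ ≤ x i + s * d i → 0ℚ ≤ x i + s′ * d i
    shorter-step {s} {s′} i 0≤s′ s′≤s 0≤x+sd with d i <? 0ℚ
    ... | yes di<0 = ≤-trans 0≤x+sd (+-monoʳ-≤ (x i) (*-monoʳ-≤-nonPos (d i) {{nonPositive (<⇒≤ di<0)}} s′≤s))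
    ... | no di≮0  = grows i 0≤s′ (≮⇒≥ di≮0)

  -- The first step at which an entry indexed by ys vanishes: if the entry at y becomes negative
  -- at the step found for ys, then it vanishes earlier.
  boundaryOn : (ys : List I) → ∀ j → d j < 0ℚ → Σ Boundary λ b → All (λ i → 0ℚ ≤ x i + step b * d i) ys
  boundaryOn []       j dj<0 = record
    { step = zeroAt (x j) (d j) dj<0 ; step≥0 = zeroAt-nonneg dj<0 (x≥0 j)
    ; tight = j ; tight<0 = dj<0 ; vanishes = zeroAt-vanishes (x j) (d j) dj<0 } , []
  boundaryOn (y ∷ ys) j dj<0 with boundaryOn ys j dj<0
  ... | b , nonneg with 0ℚ ≤? x y + step b * d y
  ...   | yes 0≤y = b , 0≤y ∷ nonneg
  ...   | no y≱0  = b′ , ≤-reflexive (sym (vanishes b′)) ∷ All.map (shorter-step _ (step≥0 b′) (<⇒≤ s′<s)) nonneg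
    where
    dy<0 : d y < 0ℚ
    dy<0 = ≰⇒> (λ 0≤dy → y≱0 (grows y (step≥0 b) 0≤dy))
    b′ : Boundary
    b′ = record
      { step = zeroAt (x y) (d y) dy<0 ; step≥0 = zeroAt-nonneg dy<0 (x≥0 y)
      ; tight = y ; tight<0 = dy<0 ; vanishes = zeroAt-vanishes (x y) (d y) dy<0 }
    s′<s : step b′ < step b
    s′<s = *-cancelʳ-<-nonPos (d y) {{nonPositive (<⇒≤ dy<0)}} (+-cancelˡ-< (x y) (begin-strict
      x y + step b * d y    <⟨ ≰⇒> y≱0 ⟩
      0ℚ                    ≡⟨ vanishes b′ ⟨
      x y + step b′ * d y   ∎))
      where open ≤-Reasoning

  lineSearch : (xs : List I) → (∀ i → i ∈ xs) → ∀ j → d j < 0ℚ → Σ Boundary λ b → ∀ i → 0ℚ ≤ x i + step b * d i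
  lineSearch xs complete j dj<0 with boundaryOn xs j dj<0
  ... | b , nonneg = b , λ i → All.lookup nonneg (complete i)

-- Fractional vertices

record IsDistribution (f : Fin q → ℚ) : Set where
  field
    nonneg : ∀ c → 0ℚ ≤ f c
    total  : ∑[ c < q ] f c ≡ 1ℚ

IsFractional : (Fin n × Fin q → ℚ) → Set
IsFractional P = ∀ t → IsDistribution (λ c → P (t , c))

Fractional : ℚ → Set
Fractional x = 0ℚ < x × x < 1ℚ

fractional? : ∀ x → Dec (Fractional x)
fractional? x = (0ℚ <? x) ×-dec (x <? 1ℚ)

∣1-x∣<1 : ∀ {x} → Fractional x → ∣ 1ℚ - x ∣ < 1ℚ
∣1-x∣<1 {x} (0<x , x<1) = begin-strict
  ∣ 1ℚ - x ∣    ≡⟨ 0≤p⇒∣p∣≡p 0≤1-x ⟩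
  1ℚ - x        <⟨ +-monoʳ-< 1ℚ (neg-antimono-< 0<x) ⟩
  1ℚ + 0ℚ       ≡⟨ +-identityʳ 1ℚ ⟩
  1ℚ            ∎
  where
  open ≤-Reasoning
  0≤1-x : 0ℚ ≤ 1ℚ - x
  0≤1-x = subst (_≤ 1ℚ - x) (+-inverseʳ x) (+-monoˡ-≤ (- x) (<⇒≤ x<1))

∣0-x∣<1 : ∀ {x} → 0ℚ ≤ x → x < 1ℚ → ∣ 0ℚ - x ∣ < 1ℚ
∣0-x∣<1 {x} 0≤x x<1 = begin-strict
  ∣ 0ℚ - x ∣    ≡⟨ cong ∣_∣ (+-identityˡ (- x)) ⟩
  ∣ - x ∣       ≡⟨ ∣-p∣≡∣p∣ x ⟩
  ∣ x ∣         ≡⟨ 0≤p⇒∣p∣≡p 0≤x ⟩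
  x             <⟨ x<1 ⟩
  1ℚ            ∎
  where open ≤-Reasoning

module Distribution {f : Fin q → ℚ} (f-dist : IsDistribution f) where
  open IsDistribution f-dist

  ≤1 : ∀ c → f c ≤ 1ℚ
  ≤1 c = subst (f c ≤_) total (term≤∑ nonneg c)

  +≤1 : ∀ {c c′} → c ≢ c′ → f c + f c′ ≤ 1ℚ
  +≤1 c≢c′ = subst (_ ≤_) total (pair≤∑ nonneg c≢c′)

  some-positive : ∃ λ c → 0ℚ < f c
  some-positive = ∑-pos⇒pos f (subst (0ℚ <_) (sym total) 0<1)

  other-positive : ∀ {c} → f c < 1ℚ → ∃ λ c′ → c′ ≢ c × 0ℚ < f c′
  other-positive {c} fc<1 = term<∑⇒other-pos f c (subst (f c <_) (sym total) fc<1)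

  deviation<1 : ∀ c a → Fractional (f c) → ∣ δ c a - f c ∣ < 1ℚ
  deviation<1 c a fr with c ≟ a
  ... | yes refl = ∣1-x∣<1 fr
  ... | no _     = ∣0-x∣<1 (nonneg c) (proj₂ fr)

  deviation≡0 : ∀ c a → 0ℚ < f a → ¬ Fractional (f c) → ∣ δ c a - f c ∣ ≡ 0ℚ
  deviation≡0 c a 0<fa ¬fr with c ≟ a
  ... | yes refl = cong (λ e → ∣ 1ℚ - e ∣) fc≡1
    where
    fc≡1 : f c ≡ 1ℚ
    fc≡1 = ≤-antisym (≤1 c) (≮⇒≥ (λ fc<1 → ¬fr (0<fa , fc<1)))
  ... | no c≢a = cong (λ e → ∣ 0ℚ - e ∣) fc≡0
    where
    fc<1 : f c < 1ℚ
    fc<1 = <-≤-trans (subst (_< f c + f a) (+-identityʳ (f c)) (+-monoʳ-< (f c) 0<fa)) (+≤1 c≢a)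
    fc≡0 : f c ≡ 0ℚ
    fc≡0 = ≤-antisym (≮⇒≥ (λ 0<fc → ¬fr (0<fc , fc<1))) (nonneg c)

  deviation≤ : ∀ c a → 0ℚ < f a → ∣ δ c a - f c ∣ ≤ ⟦ does (fractional? (f c)) ⟧
  deviation≤ c a 0<fa = aux (fractional? (f c))
    where
    aux : (d : Dec (Fractional (f c))) → ∣ δ c a - f c ∣ ≤ ⟦ does d ⟧
    aux (yes fr) = <⇒≤ (deviation<1 c a fr)
    aux (no ¬fr) = ≤-reflexive (deviation≡0 c a 0<fa ¬fr)

  support-size : ∀ c → 1ℚ + ⟦ does (fractional? (f c)) ⟧ ≤ ∑[ c′ < q ] ⟦ does (0ℚ <? f c′) ⟧
  support-size c = aux (fractional? (f c))
    where
    in-supp : ∀ {c′} → 0ℚ < f c′ → ⟦ does (0ℚ <? f c′) ⟧ ≡ 1ℚ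
    in-supp {c′} 0<fc′ = cong ⟦_⟧ (Dec.dec-true (0ℚ <? f c′) 0<fc′)
    aux : (d : Dec (Fractional (f c))) → 1ℚ + ⟦ does d ⟧ ≤ ∑[ c′ < q ] ⟦ does (0ℚ <? f c′) ⟧
    aux (yes (0<fc , fc<1)) with other-positive fc<1
    ... | c′ , c′≢c , 0<fc′ = subst₂ _≤_ (cong₂ _+_ (in-supp 0<fc) (in-supp 0<fc′)) refl
                                  (pair≤∑ (λ c″ → ⟦⟧-nonneg (does (0ℚ <? f c″))) (c′≢c ∘ sym))
    aux (no _) with some-positive
    ... | c′ , 0<fc′ = subst₂ _≤_ (trans (in-supp 0<fc′) (sym (+-identityʳ 1ℚ))) refl
                         (term≤∑ (λ c″ → ⟦⟧-nonneg (does (0ℚ <? f c″))) c′)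

n+#fractional≤count : ∀ {P : Fin n × Fin q → ℚ} → IsFractional P → ∀ (u : Vertex n q) →
                          ι n + ∑[ t < n ] ⟦ does (fractional? (P (t , u t))) ⟧ ≤ count (supp P)
n+#fractional≤count {n} {q} {P} P-frac u = begin
  ι n + F                                                 ≡⟨ cong (_+ F) (*-identityʳ (ι n)) ⟨
  ι n * 1ℚ + F                                            ≡⟨ cong (_+ F) (∑-const n 1ℚ) ⟨
  ∑[ t < n ] 1ℚ + F                                       ≡⟨ ∑-distrib-+ (λ _ → 1ℚ) (λ t → ⟦ does (fractional? (P (t , u t))) ⟧) ⟨
  ∑[ t < n ] (1ℚ + ⟦ does (fractional? (P (t , u t))) ⟧)  ≤⟨ ∑-mono-≤ (λ t → Distribution.support-size (P-frac t) (u t)) ⟩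
  count (supp P)                                          ∎
  where
  open ≤-Reasoning
  F : ℚ
  F = ∑[ t < n ] ⟦ does (fractional? (P (t , u t))) ⟧

record Shrinking (P d : Fin n × Fin q → ℚ) : Set where
  field
    step       : ℚ
    fractional : IsFractional (λ p → P p + step * d p)
    ⊆supp      : supp (λ p → P p + step * d p) ⊆ supp P
    smaller    : 1ℚ + count (supp (λ p → P p + step * d p)) ≤ count (supp P)

shrink : ∀ {P d : Fin n × Fin q → ℚ} → IsFractional P → (∀ t → ∑[ c < q ] d (t , c) ≡ 0ℚ) →
         (∀ p → supp P p ≡ false → d p ≡ 0ℚ) → ∃ (λ p → d p ≢ 0ℚ) → Shrinking P d
shrink {n} {q} {P} {d} P-frac rowSum≡0 supported (p₀ , dp₀≢0) = record
  { step       = step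
  ; fractional = λ t → record { nonneg = λ c → nonneg′ (t , c) ; total = total′ t }
  ; ⊆supp      = ⊆supp′
  ; smaller    = count-⊂ ⊆supp′ (Bool.¬-not (<⇒≢ tight<0 ∘ supported tight))
                                (Dec.dec-false (0ℚ <? P′ tight) (λ 0<P′ → <-irrefl (sym vanishes) 0<P′))
  }
  where
  nonneg : ∀ p → 0ℚ ≤ P p
  nonneg (t , c) = IsDistribution.nonneg (P-frac t) c
  -- A row of d with a positive entry also has a negative one, since its sum is 0.
  descent : ∃ λ p → d p < 0ℚ
  descent with <-cmp (d p₀) 0ℚ
  ... | tri< dp₀<0 _ _ = p₀ , dp₀<0
  ... | tri≈ _ dp₀≡0 _ = contradiction dp₀≡0 dp₀≢0
  ... | tri> _ _ 0<dp₀ with ∑≡0⇒neg (λ c → d (proj₁ p₀ , c)) (rowSum≡0 (proj₁ p₀)) (proj₂ p₀) 0<dp₀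
  ...   | c , neg = (proj₁ p₀ , c) , neg
  search : Σ (Boundary P d nonneg) λ b → ∀ p → 0ℚ ≤ P p + Boundary.step b * d p
  search = lineSearch P d nonneg (cartesianProduct (allFin n) (allFin q))
                      (λ (t , c) → ∈-cartesianProduct⁺ (∈-allFin t) (∈-allFin c)) (proj₁ descent) (proj₂ descent)
  open Boundary (proj₁ search)
  P′ : Fin n × Fin q → ℚ
  P′ p = P p + step * d p
  nonneg′ : ∀ p → 0ℚ ≤ P′ p
  nonneg′ = proj₂ search
  total′ : ∀ t → ∑[ c < q ] P′ (t , c) ≡ 1ℚ
  total′ t = begin
    ∑[ c < q ] (P (t , c) + step * d (t , c))             ≡⟨ ∑-distrib-+ (λ c → P (t , c)) (λ c → step * d (t , c)) ⟩
    ∑[ c < q ] P (t , c) + ∑[ c < q ] (step * d (t , c))  ≡⟨ cong₂ _+_ (IsDistribution.total (P-frac t)) (sym (*-distribˡ-sum step (λ c → d (t , c)))) ⟩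
    1ℚ + step * ∑[ c < q ] d (t , c)                      ≡⟨ cong (λ e → 1ℚ + step * e) (rowSum≡0 t) ⟩
    1ℚ + step * 0ℚ                                        ≡⟨ cong (_+_ 1ℚ) (*-zeroʳ step) ⟩
    1ℚ + 0ℚ                                               ≡⟨ +-identityʳ 1ℚ ⟩
    1ℚ                                                    ∎
    where open ≡-Reasoning
  ⊆supp′ : supp P′ ⊆ supp P
  ⊆supp′ p P′p = Bool.¬-not λ Pp≡false → <-irrefl refl (begin-strict
    0ℚ                 <⟨ ∈-supp⁻ {x = P′} {p} P′p ⟩
    P p + step * d p   ≡⟨ cong (λ e → P p + step * e) (supported p Pp≡false) ⟩
    P p + step * 0ℚ    ≡⟨ cong (_+_ (P p)) (*-zeroʳ step) ⟩
    P p + 0ℚ           ≡⟨ +-identityʳ (P p) ⟩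
    P p                ≤⟨ ∉-supp⁻ {x = P} {p} Pp≡false ⟩
    0ℚ                 ∎)
    where open ≤-Reasoning

record Sparsification (ℓ : Fin k → Fin n × Fin q → ℚ) (P : Fin n × Fin q → ℚ) : Set where
  field
    point      : Fin n × Fin q → ℚ
    fractional : IsFractional point
    ⊆supp      : supp point ⊆ supp P
    preserves  : ∀ j → ⟨ ℓ j , point ⟩ ≡ ⟨ ℓ j , P ⟩
    small      : count (supp point) ≤ ι (n ℕ.+ k)

-- N bounds the size of the support, which drops by one in each step.
sparsifyWithin : ∀ N (ℓ : Fin k → Fin n × Fin q → ℚ) {P} → IsFractional P → count (supp P) ≤ ι N → Sparsification ℓ P
sparsifyWithin {k} {n} {q} N ℓ {P} P-frac bound = [ done , reduce N bound ∘ ≰⇒> ]′ (Dec.toSum (count (supp P) ≤? ι (n ℕ.+ k)))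
  where
  done : count (supp P) ≤ ι (n ℕ.+ k) → Sparsification ℓ P
  done small = record { point = P ; fractional = P-frac ; ⊆supp = λ _ Pp → Pp ; preserves = λ _ → refl ; small = small }
  reduce : ∀ N → count (supp P) ≤ ι N → ι (n ℕ.+ k) < count (supp P) → Sparsification ℓ P
  reduce zero    bound big = contradiction (≤-<-trans (ι-nonneg (n ℕ.+ k)) (<-≤-trans big bound)) (<-irrefl refl)
  reduce (suc N) bound big = record
    { point      = point
    ; fractional = fractional
    ; ⊆supp      = λ p → ⊆supp-P′ p ∘ ⊆supp p
    ; preserves  = λ j → trans (preserves j) (⟨⟩-along-⊥ (ℓ j) P vec step (ℓ⊥vec j))
    ; small      = small
    }
    where
    open NonTrivialSolution (nonTrivialSolution (n ℕ.+ k) (rowχ ++ ℓ) (supp P) big)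
    rowχ⊥vec : ∀ t → ⟨ rowχ t , vec ⟩ ≡ 0ℚ
    rowχ⊥vec = proj₁ (∀-++ {P = λ r → ⟨ r , vec ⟩ ≡ 0ℚ} rowχ ℓ solves)
    ℓ⊥vec : ∀ j → ⟨ ℓ j , vec ⟩ ≡ 0ℚ
    ℓ⊥vec = proj₂ (∀-++ {P = λ r → ⟨ r , vec ⟩ ≡ 0ℚ} rowχ ℓ solves)
    open Shrinking (shrink P-frac (λ t → trans (sym (⟨rowχ,-⟩ t vec)) (rowχ⊥vec t)) supported nonzero)
      renaming (fractional to P′-frac; ⊆supp to ⊆supp-P′)
    bound′ : count (supp (λ p → P p + step * vec p)) ≤ ι N
    bound′ = +-cancelˡ-≤ 1ℚ (≤-trans smaller (subst (count (supp P) ≤_) (ι-+ 1 N) bound))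
    open Sparsification (sparsifyWithin N ℓ P′-frac bound′)

sparsify : ∀ (ℓ : Fin k → Fin n × Fin q → ℚ) {P} → IsFractional P → Sparsification ℓ P
sparsify {n = n} {q} ℓ {P} P-frac = sparsifyWithin (n ℕ.* q) ℓ P-frac (count≤n*q (supp P))

-- Rounding

Rounds : (Fin n × Fin q → ℚ) → Vertex n q → Set
Rounds P w = ∀ t → 0ℚ < P (t , w t)

agreement : Vertex n q → Vertex n q → ℚ
agreement {n} u w = ∑[ t < n ] δ (u t) (w t)

agreementᶠ : Vertex n q → (Fin n × Fin q → ℚ) → ℚ
agreementᶠ {n} u P = ∑[ t < n ] P (t , u t)

-- Only the coordinates t with P (t , u t) fractional contribute to the error, each less than 1,
-- and there are at most k + 1 of them since each such row carries two support elements.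
sparse⇒close : ∀ {P : Fin n × Fin q → ℚ} → IsFractional P → ∀ u {w} → Rounds P w →
               count (supp P) ≤ ι (n ℕ.+ suc k) → ∣ agreement u w - agreementᶠ u P ∣ < ι (suc k)
sparse⇒close {n} {q} {k} {P} P-frac u {w} rounds small = begin-strict
  ∣ agreement u w - agreementᶠ u P ∣              ≡⟨ cong ∣_∣ (∑-distrib-- (λ t → δ (u t) (w t)) (λ t → P (t , u t))) ⟨
  ∣ ∑[ t < n ] (δ (u t) (w t) - P (t , u t)) ∣    ≤⟨ ∣∑∣≤∑∣∣ (λ t → δ (u t) (w t) - P (t , u t)) ⟩
  ∑[ t < n ] deviation t                          <⟨ ∑deviation< (any? (λ t → fractional? (P (t , u t)))) ⟩
  ι (suc k)                                       ∎
  where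
  open ≤-Reasoning
  module D t = Distribution (P-frac t)
  deviation : Fin n → ℚ
  deviation t = ∣ δ (u t) (w t) - P (t , u t) ∣
  fractionalCount≤k : ∑[ t < n ] ⟦ does (fractional? (P (t , u t))) ⟧ ≤ ι (suc k)
  fractionalCount≤k = +-cancelˡ-≤ (ι n) (≤-trans (n+#fractional≤count P-frac u) (subst (count (supp P) ≤_) (ι-+ n (suc k)) small))
  ∑deviation< : Dec (∃ λ t → Fractional (P (t , u t))) → ∑[ t < n ] deviation t < ι (suc k)
  ∑deviation< (yes (t , fr)) = <-≤-trans (∑-mono-< (λ t → D.deviation≤ t (u t) (w t) (rounds t)) t deviation<⟦⟧) fractionalCount≤k
    where
    deviation<⟦⟧ : deviation t < ⟦ does (fractional? (P (t , u t))) ⟧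
    deviation<⟦⟧ = subst (deviation t <_) (cong ⟦_⟧ (sym (Dec.dec-true (fractional? (P (t , u t))) fr))) (D.deviation<1 t (u t) (w t) fr)
  ∑deviation< (no none) = begin-strict
    ∑[ t < n ] deviation t   ≡⟨ sum-cong-≗ (λ t → D.deviation≡0 t (u t) (w t) (rounds t) (none ∘ (t ,_))) ⟩
    ∑[ t < n ] 0ℚ            ≡⟨ ∑-zero n ⟩
    0ℚ                       ≤⟨ ι-nonneg k ⟩
    ι k                      <⟨ ι<ι-suc k ⟩
    ι (suc k)                ∎

record Rounding (u : Fin k → Vertex n q) (P : Fin n × Fin q → ℚ) : Set where
  field
    vertex : Vertex n q
    rounds : Rounds P vertex
    close  : ∀ j → ∣ agreement (u j) vertex - agreementᶠ (u j) P ∣ < ι (suc (toℕ j))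

iteratedRounding : ∀ (u : Fin k → Vertex n q) {P} → IsFractional P → Rounding u P
iteratedRounding {zero} u P-frac = record
  { vertex = λ t → proj₁ (Distribution.some-positive (P-frac t))
  ; rounds = λ t → proj₂ (Distribution.some-positive (P-frac t))
  ; close  = λ ()
  }
iteratedRounding {suc k} u {P} P-frac = record { vertex = vertex ; rounds = rounds-P ; close = close′ }
  where
  open Sparsification (sparsify (χ ∘ u) P-frac)
  open Rounding (iteratedRounding (u ∘ inject₁) fractional)
  rounds-P : Rounds P vertex
  rounds-P t = ∈-supp⁻ {x = P} (⊆supp _ (∈-supp⁺ {x = point} (rounds t)))
  agreementᶠ-preserved : ∀ j → agreementᶠ (u j) point ≡ agreementᶠ (u j) P
  agreementᶠ-preserved j = trans (sym (⟨χ,-⟩ (u j) point)) (trans (preserves j) (⟨χ,-⟩ (u j) P))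
  close′ : ∀ j → ∣ agreement (u j) vertex - agreementᶠ (u j) P ∣ < ι (suc (toℕ j))
  close′ j = byView (view j)
    where
    byView : ∀ {j} → View j → ∣ agreement (u j) vertex - agreementᶠ (u j) P ∣ < ι (suc (toℕ j))
    byView ‵fromℕ = subst₂ (λ a b → ∣ agreement (u (fromℕ k)) vertex - a ∣ < ι (suc b))
                      (agreementᶠ-preserved (fromℕ k)) (sym (toℕ-fromℕ k))
                      (sparse⇒close fractional (u (fromℕ k)) rounds small)
    byView (‵inj₁ {i = j′} _) = subst₂ (λ a b → ∣ agreement (u (inject₁ j′)) vertex - a ∣ < ι (suc b))
                      (agreementᶠ-preserved (inject₁ j′)) (sym (toℕ-inject₁ j′))
                      (close j′)

uniform-fractional : ∀ q .{{_ : NonZero q}} → IsFractional {n} {q} (λ _ → + 1 / q)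
uniform-fractional q t = record
  { nonneg = λ _ → nonNegative⁻¹ (+ 1 / q) {{normalize-nonNeg 1 q}}
  ; total  = trans (∑-const q (+ 1 / q)) (ι*1/ q)
  }

dist+agreement : ∀ (u w : Vertex n q) → ι (dist u w) + agreement u w ≡ ι n
dist+agreement {zero}  u w = refl
dist+agreement {suc n} u w = begin
  ι (b ℕ.+ D) + (δ (u zero) (w zero) + A)          ≡⟨ cong (_+ (δ (u zero) (w zero) + A)) (ι-+ b D) ⟩
  (ι b + ι D) + (δ (u zero) (w zero) + A)          ≡⟨ solve 4 (λ x y z t → (x :+ y) :+ (z :+ t) := (x :+ z) :+ (y :+ t)) refl (ι b) (ι D) (δ (u zero) (w zero)) A ⟩
  (ι b + δ (u zero) (w zero)) + (ι D + A)          ≡⟨ cong₂ _+_ (mismatch+match (does (u zero ≟ w zero))) (dist+agreement (u ∘ suc) (w ∘ suc)) ⟩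
  1ℚ + ι n                                          ≡⟨ ι-+ 1 n ⟨
  ι (suc n)                                         ∎
  where
  open ≡-Reasoning
  open +-*-Solver using (solve; _:+_; _:=_)
  b D : ℕ
  b = if does (u zero ≟ w zero) then 0 else 1
  D = dist (u ∘ suc) (w ∘ suc)
  A : ℚ
  A = agreement (u ∘ suc) (w ∘ suc)
  mismatch+match : ∀ e → ι (if e then 0 else 1) + ⟦ e ⟧ ≡ 1ℚ
  mismatch+match true  = refl
  mismatch+match false = refl

lemma1p5 : (q n : ℕ) → .{{_ : NonZero q}} → q ≥ 3 → n ≥ 1 → (v : Fin n → Vertex n q) →
    ∃ λ (w : Vertex n q) → (i : Fin n) →
      ∣ (1ℚ - (+ 1) / q) * ((+ n) / 1) - (+ dist (v i) w) / 1 ∣ < (+ suc (toℕ i)) / 1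
lemma1p5 q n _ _ v = vertex , λ i → subst (λ x → ∣ x ∣ < ι (suc (toℕ i))) (deviation≡ i) (close i)
  where
  r : ℚ
  r = + 1 / q
  open Rounding (iteratedRounding v (uniform-fractional {n} q))
  deviation≡ : ∀ i → agreement (v i) vertex - agreementᶠ (v i) (λ _ → r) ≡ (1ℚ - r) * ι n - ι (dist (v i) vertex)
  deviation≡ i = begin
    A - ∑[ t < n ] r                ≡⟨ cong (_-_ A) (∑-const n r) ⟩
    A - ι n * r                     ≡⟨ cong (λ N → A - N * r) (dist+agreement (v i) vertex) ⟨
    A - (D + A) * r                 ≡⟨ solve 3 (λ a d x → a :- (d :+ a) :* x := (con 1ℚ :- x) :* (d :+ a) :- d) refl A D r ⟩
    (1ℚ - r) * (D + A) - D          ≡⟨ cong (λ N → (1ℚ - r) * N - D) (dist+agreement (v i) vertex) ⟩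
    (1ℚ - r) * ι n - D              ∎
    where
    open ≡-Reasoning
    open +-*-Solver
    A D : ℚ
    A = agreement (v i) vertex
    D = ι (dist (v i) vertex)
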